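{- Let $T_{3,1}$ be the polyiamond consisting of three equilateral triangles of the triangular tiling that are consecutive around a common vertex (its union is a trapezoid). Then $\tau(T_{3,1})=(1,5,\infty)$, i.e. $T_{3,1}$ is a $(1,1)$-winner, a $(1,2)$-loser, a $(2,5)$-winner, a $(2,6)$-loser, and an $(n,b)$-winner for all $n\ge3$ and all $b\ge0$.
   Context: The board is the tiling of the plane by unit equilateral triangles (cells); cells are adjacent if they share an edge. A polyiamond is a finite connected set of cells up to congruence. In the weak $(a,b)$ achievement game ($a\ge1,b\ge0$) for a goal polyiamond $A$ on the infinite board, maker and breaker alternately mark previously unmarked cells, maker first, $a$ resp. $b$ cells per turn; the maker wins if his marked cells at some point contain a set congruent to $A$; $A$ is an $(a,b)$-winner if the maker has a strategy guaranteeing a win in finitely many turns against every breaker play, otherwise an $(a,b)$-loser. The threshold sequence $\tau(A)=(b_1,b_2,\ldots)$ has $b_n$ the greatest $b$ for which $A$ is an $(n,b)$-winner ($\infty$ if for all $b$); $(b_1,\ldots,b_{k-1},\infty)$ denotes the sequence with $b_n=\infty$ for all $n\ge k$. -}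

module Defs where

open import Data.Nat using (ℕ)
open import Data.Integer using (ℤ; +_; -[1+_]; _+_; _-_; -1ℤ; 0ℤ)
open import Data.Bool using (Bool; true; false)
open import Data.Product using (_×_; _,_; ∃)
open import Data.Sum using (_⊎_)
open import Data.List using (List; []; _∷_; _++_; length)
open import Data.List.Membership.Propositional using (_∈_)
open import Data.List.Relation.Unary.All using (All)
open import Data.List.Relation.Unary.Unique.Propositional using (Unique)
open import Relation.Binary.PropositionalEquality using (_≡_)
open import Relation.Nullary using (¬_)

-- The plane is {(x,y,z) ∈ ℝ³ | x+y+z = 0}; the lines x ∈ ℤ, y ∈ ℤ, z ∈ ℤ
-- cut it into unit equilateral triangles.  A cell is named by the triple
-- of floors (⌊x⌋,⌊y⌋,⌊z⌋) of its interior points; these are exactly the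
-- integer triples with a+b+c = -1 ("up" cells) or a+b+c = -2 ("down").
-- Two cells share an edge iff they differ by 1 in exactly one coordinate.

Triple : Set
Triple = ℤ × ℤ × ℤ

sum3 : Triple → ℤ
sum3 (a , b , c) = a + b + c

IsCell : Triple → Set
IsCell t = sum3 t ≡ -[1+ 0 ] ⊎ sum3 t ≡ -[1+ 1 ]

Adjacent : Triple → Triple → Set
Adjacent (a , b , c) (a' , b' , c') =
    (a' ≡ a - + 1 × b' ≡ b × c' ≡ c)
  ⊎ (a' ≡ a × b' ≡ b - + 1 × c' ≡ c)
  ⊎ (a' ≡ a × b' ≡ b × c' ≡ c - + 1)
  ⊎ (a ≡ a' - + 1 × b ≡ b' × c ≡ c')
  ⊎ (a ≡ a' × b ≡ b' - + 1 × c ≡ c')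
  ⊎ (a ≡ a' × b ≡ b' × c ≡ c' - + 1)

-- Symmetries of the tiling: x ↦ σ(±x) + t, σ a permutation of the three
-- coordinates, t an integer vector with coordinate sum 0 (a vertex-lattice
-- translation).  On floors, the point reflection x ↦ -x acts as a ↦ -1-a.
-- These form the full symmetry group p6m of the tiling; congruent
-- polyiamonds are exactly images under these maps.

data Perm : Set where
  p123 p132 p213 p231 p312 p321 : Perm

permute : Perm → Triple → Triple
permute p123 (a , b , c) = a , b , c
permute p132 (a , b , c) = a , c , b
permute p213 (a , b , c) = b , a , c
permute p231 (a , b , c) = b , c , a
permute p312 (a , b , c) = c , a , b
permute p321 (a , b , c) = c , b , a

reflect : Bool → Triple → Triple
reflect false t = t
reflect true (a , b , c) = (-1ℤ - a) , (-1ℤ - b) , (-1ℤ - c)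

record Isometry : Set where
  field
    perm   : Perm
    flip   : Bool
    shift  : Triple
    shift0 : sum3 shift ≡ 0ℤ

applyIso : Isometry → Triple → Triple
applyIso g t with Isometry.shift g | permute (Isometry.perm g) (reflect (Isometry.flip g) t)
... | (u , v , w) | (a , b , c) = (a + u) , (b + v) , (c + w)

ContainsCopy : List Triple → List Triple → Set
ContainsCopy A S = ∃ λ (g : Isometry) → All (λ x → applyIso g x ∈ S) A

-- The goal polyiamond T_{3,1}: the three cells around the vertex (0,0,0)
-- forming down–up–down: the up cell (-1,0,0) and its two neighbours
-- (-1,-1,0) and (-1,0,-1) (three consecutive cells around a vertex).

T31 : List Triple
T31 = (-1ℤ , -1ℤ , 0ℤ) ∷ (-1ℤ , 0ℤ , 0ℤ) ∷ (-1ℤ , 0ℤ , -1ℤ) ∷ []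

LegalMove : ℕ → List Triple → List Triple → Set
LegalMove k marked m =
  length m ≡ k × Unique m × All IsCell m × All (λ x → ¬ (x ∈ marked)) m

-- MakerWins A a b M B : in the position where maker has marked M and
-- breaker has marked B, with maker to move, maker has a strategy that wins
-- in finitely many turns against every breaker play (inductive, i.e.
-- well-founded, game tree).
data MakerWins (A : List Triple) (a b : ℕ) : List Triple → List Triple → Set where
  move : ∀ {M B} (m : List Triple) → LegalMove a (M ++ B) m →
         (ContainsCopy A (m ++ M)
           ⊎ ((br : List Triple) → LegalMove b (m ++ M ++ B) br →
                MakerWins A a b (m ++ M) (br ++ B))) →
         MakerWins A a b M B

Winner : List Triple → ℕ → ℕ → Set
Winner A a b = MakerWins A a b [] []

module Submission where

-- Geometry: every copy of T₃,₁ is a wedge, a cell with two distinct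
-- neighbours, one of them across a B- or C-edge (copy⇒wedge).  The board is
-- infinite, so a player can always fill up a move with fresh cells
-- (freshMove); in particular breaker can occupy any k candidate cells
-- (blockMove).
-- Losers: breaker maintains an invariant that excludes wedges
-- (invariant⇒noWin); for (1,b), b ≥ 2, he takes the B/C-neighbours of
-- maker's cell, for (2,b), b ≥ 6, all neighbours of maker's two cells.
-- Winners: for (1,1) maker creates three threats against two breaker cells
-- (pigeonhole); for (2,5) he takes the centres of two far-apart stars, and
-- five breaker cells cannot cover both; for n ≥ 3 he places a copy at once.

open import Defs
open import Data.Nat as ℕ using (ℕ; zero; suc; _≤_; _<_; _∸_; _⊔_; z≤n; s≤s)
import Data.Nat.Properties as ℕP
open import Data.Integer as ℤ using (ℤ; +_; -[1+_]; 0ℤ; -1ℤ; 1ℤ; _+_; _-_; ∣_∣)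
import Data.Integer.Properties as ℤP
open import Data.Integer.Tactic.RingSolver using (solve-∀)
open import Data.Bool using (Bool; true; false)
open import Data.Product using (_×_; _,_; ∃; proj₁; proj₂)
open import Data.Product.Properties using (≡-dec)
open import Data.Sum using (_⊎_; inj₁; inj₂)
import Data.Sum as Sum
open import Data.Maybe using (Maybe; just; nothing; from-just; _<∣>_)
open import Data.Maybe.Effectful using (applicative)
open import Data.List using (List; []; _∷_; _++_; length; map; foldr; concatMap; mapMaybe; filter; deduplicate)
open import Data.List.Properties using (length-++; length-map; length-filter; length-deduplicate; ++-identityʳ)
open import Data.List.Membership.Propositional using (_∈_; _∉_; find)
open import Data.List.Membership.Propositional.Properties using (∈-++⁺ˡ; ∈-++⁺ʳ; ∈-++⁻; ∈-map⁺; ∈-filter⁺; ∈-deduplicate⁺)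
open import Data.List.Relation.Unary.Any using (here; there; any?)
open import Data.List.Relation.Unary.All as All using (All; []; _∷_)
import Data.List.Relation.Unary.All.Properties as AllP
open import Data.List.Relation.Unary.Unique.Propositional using (Unique; []; _∷_)
import Data.List.Relation.Unary.Unique.Propositional.Properties as UniqueP
open import Relation.Binary.PropositionalEquality
open import Relation.Binary.Definitions using (DecidableEquality)
open import Relation.Nullary using (¬_; Dec; yes; no)
open import Relation.Nullary.Decidable using (from-yes; _⊎-dec_; _×-dec_; ¬?)
open import Data.Empty using (⊥; ⊥-elim)
open import Level using (0ℓ)
open import Function using (_∘_; case_of_)

_≟T_ : DecidableEquality Triple
_≟T_ = ≡-dec ℤ._≟_ (≡-dec ℤ._≟_ ℤ._≟_)

open import Data.List.Membership.DecPropositional _≟T_ using (_∈?_)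
open import Data.List.Relation.Unary.Unique.DecPropositional _≟T_ using (unique?)
open import Data.List.Relation.Unary.Unique.DecPropositional.Properties _≟T_ using (deduplicate-!)

isCell? : (t : Triple) → Dec (IsCell t)
isCell? t = (sum3 t ℤ.≟ -[1+ 0 ]) ⊎-dec (sum3 t ℤ.≟ -[1+ 1 ])

legal? : ∀ k marked m → Dec (LegalMove k marked m)
legal? k marked m = (length m ℕ.≟ k) ×-dec unique? m ×-dec All.all? isCell? m ×-dec All.all? (λ z → ¬? (z ∈? marked)) m

-- Searching for a copy of a polyiamond A inside a finite set S: it suffices
-- to try the symmetries that send the first cell of A onto a cell of S.

addT : Triple → Triple → Triple
addT (a , b , c) (u , v , w) = (a + u) , (b + v) , (c + w)

subT : Triple → Triple → Triple
subT (a , b , c) (u , v , w) = (a - u) , (b - v) , (c - w)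

identity : Isometry
identity = record { perm = p123 ; flip = false ; shift = 0ℤ , 0ℤ , 0ℤ ; shift0 = refl }

symmetryTo : Perm → Bool → Triple → Triple → Maybe Isometry
symmetryTo p f a t with sum3 (subT t (permute p (reflect f a))) ℤ.≟ 0ℤ
... | yes s0 = just (record { perm = p ; flip = f ; shift = subT t (permute p (reflect f a)) ; shift0 = s0 })
... | no _ = nothing

placeBy : (A S : List Triple) → Isometry → Maybe (ContainsCopy A S)
placeBy A S g with All.all? (λ x → applyIso g x ∈? S) A
... | yes inside = just (g , inside)
... | no _ = nothing

searchCopy : (A S : List Triple) → Maybe (ContainsCopy A S)
searchCopy [] S = just (identity , [])
searchCopy A@(a₀ ∷ _) S = foldr (λ g found → placeBy A S g <∣> found) nothing candidates
  where
  candidates : List Isometry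
  candidates = concatMap (λ p → concatMap (λ f → mapMaybe (symmetryTo p f a₀) S) (false ∷ true ∷ []))
                 (p123 ∷ p132 ∷ p213 ∷ p231 ∷ p312 ∷ p321 ∷ [])

searchAll : ∀ {X : Set} {P : X → Set} → (∀ x → Maybe (P x)) → ∀ xs → Maybe (All P xs)
searchAll search xs = All.sequenceA 0ℓ applicative (All.universal search xs)

data Dir : Set where
  A+ A- B+ B- C+ C- : Dir

nb : Dir → Triple → Triple
nb A+ (a , b , c) = (a + 1ℤ) , b , c
nb A- (a , b , c) = (a - 1ℤ) , b , c
nb B+ (a , b , c) = a , (b + 1ℤ) , c
nb B- (a , b , c) = a , (b - 1ℤ) , c
nb C+ (a , b , c) = a , b , (c + 1ℤ)
nb C- (a , b , c) = a , b , (c - 1ℤ)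

opp : Dir → Dir
opp A+ = A-
opp A- = A+
opp B+ = B-
opp B- = B+
opp C+ = C-
opp C- = C+

data AcrossBC : Dir → Set where
  b+ : AcrossBC B+
  b- : AcrossBC B-
  c+ : AcrossBC C+
  c- : AcrossBC C-

opp-AcrossBC : ∀ {d} → AcrossBC d → AcrossBC (opp d)
opp-AcrossBC b+ = b-
opp-AcrossBC b- = b+
opp-AcrossBC c+ = c-
opp-AcrossBC c- = c+

private
  +1-1 : ∀ a → a + 1ℤ - 1ℤ ≡ a
  +1-1 = solve-∀
  -1+1 : ∀ a → a - 1ℤ + 1ℤ ≡ a
  -1+1 = solve-∀
  +1-swap : ∀ a u → a + u + 1ℤ ≡ a + 1ℤ + u
  +1-swap = solve-∀
  -1-swap : ∀ a u → a + u - 1ℤ ≡ a - 1ℤ + u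
  -1-swap = solve-∀
  +-sub : ∀ a u → a + u - u ≡ a
  +-sub = solve-∀

  +1≢ : ∀ a → a + 1ℤ ≢ a
  +1≢ a e = ℤP.i≢suc[i] (sym (trans (ℤP.+-comm 1ℤ a) e))

  -1≢ : ∀ a → a - 1ℤ ≢ a
  -1≢ a e = +1≢ (a - 1ℤ) (trans (-1+1 a) (sym e))

  +-cancelʳ : ∀ {a a'} u → a + u ≡ a' + u → a ≡ a'
  +-cancelʳ {a} {a'} u e = trans (sym (+-sub a u)) (trans (cong (_- u) e) (+-sub a' u))

nb-opp : ∀ d x → nb (opp d) (nb d x) ≡ x
nb-opp A+ (a , b , c) = cong (λ z → z , b , c) (+1-1 a)
nb-opp A- (a , b , c) = cong (λ z → z , b , c) (-1+1 a)
nb-opp B+ (a , b , c) = cong (λ z → a , z , c) (+1-1 b)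
nb-opp B- (a , b , c) = cong (λ z → a , z , c) (-1+1 b)
nb-opp C+ (a , b , c) = cong (λ z → a , b , z) (+1-1 c)
nb-opp C- (a , b , c) = cong (λ z → a , b , z) (-1+1 c)

nb-irrefl : ∀ d x → nb d x ≢ x
nb-irrefl A+ (a , b , c) e = +1≢ a (cong proj₁ e)
nb-irrefl A- (a , b , c) e = -1≢ a (cong proj₁ e)
nb-irrefl B+ (a , b , c) e = +1≢ b (cong (proj₁ ∘ proj₂) e)
nb-irrefl B- (a , b , c) e = -1≢ b (cong (proj₁ ∘ proj₂) e)
nb-irrefl C+ (a , b , c) e = +1≢ c (cong (proj₂ ∘ proj₂) e)
nb-irrefl C- (a , b , c) e = -1≢ c (cong (proj₂ ∘ proj₂) e)

nb-addT : ∀ d x s → nb d (addT x s) ≡ addT (nb d x) s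
nb-addT A+ (a , b , c) (u , v , w) = cong (λ z → z , b + v , c + w) (+1-swap a u)
nb-addT A- (a , b , c) (u , v , w) = cong (λ z → z , b + v , c + w) (-1-swap a u)
nb-addT B+ (a , b , c) (u , v , w) = cong (λ z → a + u , z , c + w) (+1-swap b v)
nb-addT B- (a , b , c) (u , v , w) = cong (λ z → a + u , z , c + w) (-1-swap b v)
nb-addT C+ (a , b , c) (u , v , w) = cong (λ z → a + u , b + v , z) (+1-swap c w)
nb-addT C- (a , b , c) (u , v , w) = cong (λ z → a + u , b + v , z) (-1-swap c w)

addT-injective : ∀ x y s → addT x s ≡ addT y s → x ≡ y
addT-injective (a , b , c) (a' , b' , c') (u , v , w) e =
  cong₂ _,_ (+-cancelʳ u (cong proj₁ e))
            (cong₂ _,_ (+-cancelʳ v (cong (proj₁ ∘ proj₂) e)) (+-cancelʳ w (cong (proj₂ ∘ proj₂) e)))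

record Wedge (S : List Triple) : Set where
  field
    centre   : Triple
    d₁ d₂    : Dir
    centre∈  : centre ∈ S
    arm₁∈    : nb d₁ centre ∈ S
    arm₂∈    : nb d₂ centre ∈ S
    distinct : nb d₁ centre ≢ nb d₂ centre
    acrossBC : AcrossBC d₁ ⊎ AcrossBC d₂

relocate : ∀ {S T} (w : Wedge S) → let open Wedge w in
           centre ∈ T → nb d₁ centre ∈ T → nb d₂ centre ∈ T → Wedge T
relocate w c∈ a₁∈ a₂∈ = record
  { centre = centre ; d₁ = d₁ ; d₂ = d₂ ; centre∈ = c∈ ; arm₁∈ = a₁∈ ; arm₂∈ = a₂∈
  ; distinct = distinct ; acrossBC = acrossBC }
  where open Wedge w

-- T₃,₁ is the up cell tC with its neighbours tP (across the B-edge) and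
-- tR (across the C-edge)
tP tC tR : Triple
tP = -1ℤ , -1ℤ , 0ℤ
tC = -1ℤ , 0ℤ , 0ℤ
tR = -1ℤ , 0ℤ , -1ℤ

linear : Perm → Bool → Triple → Triple
linear p f t = permute p (reflect f t)

record LinearWedge (p : Perm) (f : Bool) : Set where
  field
    d₁ d₂    : Dir
    arm₁     : linear p f tP ≡ nb d₁ (linear p f tC)
    arm₂     : linear p f tR ≡ nb d₂ (linear p f tC)
    distinct : linear p f tP ≢ linear p f tR
    acrossBC : AcrossBC d₁ ⊎ AcrossBC d₂

linearWedge : ∀ p f → LinearWedge p f
linearWedge p123 false = record { d₁ = B- ; d₂ = C- ; arm₁ = refl ; arm₂ = refl ; distinct = λ () ; acrossBC = inj₁ b- }
linearWedge p132 false = record { d₁ = C- ; d₂ = B- ; arm₁ = refl ; arm₂ = refl ; distinct = λ () ; acrossBC = inj₁ c- }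
linearWedge p213 false = record { d₁ = A- ; d₂ = C- ; arm₁ = refl ; arm₂ = refl ; distinct = λ () ; acrossBC = inj₂ c- }
linearWedge p231 false = record { d₁ = A- ; d₂ = B- ; arm₁ = refl ; arm₂ = refl ; distinct = λ () ; acrossBC = inj₂ b- }
linearWedge p312 false = record { d₁ = C- ; d₂ = A- ; arm₁ = refl ; arm₂ = refl ; distinct = λ () ; acrossBC = inj₁ c- }
linearWedge p321 false = record { d₁ = B- ; d₂ = A- ; arm₁ = refl ; arm₂ = refl ; distinct = λ () ; acrossBC = inj₁ b- }
linearWedge p123 true  = record { d₁ = B+ ; d₂ = C+ ; arm₁ = refl ; arm₂ = refl ; distinct = λ () ; acrossBC = inj₁ b+ }
linearWedge p132 true  = record { d₁ = C+ ; d₂ = B+ ; arm₁ = refl ; arm₂ = refl ; distinct = λ () ; acrossBC = inj₁ c+ }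
linearWedge p213 true  = record { d₁ = A+ ; d₂ = C+ ; arm₁ = refl ; arm₂ = refl ; distinct = λ () ; acrossBC = inj₂ c+ }
linearWedge p231 true  = record { d₁ = A+ ; d₂ = B+ ; arm₁ = refl ; arm₂ = refl ; distinct = λ () ; acrossBC = inj₂ b+ }
linearWedge p312 true  = record { d₁ = C+ ; d₂ = A+ ; arm₁ = refl ; arm₂ = refl ; distinct = λ () ; acrossBC = inj₁ c+ }
linearWedge p321 true  = record { d₁ = B+ ; d₂ = A+ ; arm₁ = refl ; arm₂ = refl ; distinct = λ () ; acrossBC = inj₁ b+ }

-- Translating the linear wedge by the shift of the symmetry.
copy⇒wedge : ∀ {S} → ContainsCopy T31 S → Wedge S
copy⇒wedge {S} (g , p∈ ∷ c∈ ∷ r∈ ∷ []) = record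
  { centre = applyIso g tC ; d₁ = W.d₁ ; d₂ = W.d₂ ; centre∈ = c∈
  ; arm₁∈ = subst (_∈ S) (arm W.d₁ W.arm₁) p∈
  ; arm₂∈ = subst (_∈ S) (arm W.d₂ W.arm₂) r∈
  ; distinct = λ e → W.distinct (addT-injective _ _ s
                 (trans (arm W.d₁ W.arm₁) (trans e (sym (arm W.d₂ W.arm₂)))))
  ; acrossBC = W.acrossBC }
  where
  open Isometry g using (perm; flip)
  module W = LinearWedge (linearWedge perm flip)
  s = Isometry.shift g
  arm : ∀ d {t} → linear perm flip t ≡ nb d (linear perm flip tC) →
        addT (linear perm flip t) s ≡ nb d (addT (linear perm flip tC) s)
  arm d e = trans (cong (λ z → addT z s) e) (sym (nb-addT d _ s))

-- Crossing an edge changes the coordinate sum by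
-- ±1, so an up cell (sum -1) has its neighbours in the three negative
-- directions and a down cell (sum -2) in the three positive ones.

isUp : Triple → Bool
isUp x with sum3 x ℤ.≟ -[1+ 0 ]
... | yes _ = true
... | no _ = false

sideDirs : Bool → List Dir
sideDirs true  = A- ∷ B- ∷ C- ∷ []
sideDirs false = A+ ∷ B+ ∷ C+ ∷ []

bcDirs : Bool → List Dir
bcDirs true  = B- ∷ C- ∷ []
bcDirs false = B+ ∷ C+ ∷ []

cellNbs : Triple → List Triple
cellNbs x = map (λ d → nb d x) (sideDirs (isUp x))

bcNbs : Triple → List Triple
bcNbs x = map (λ d → nb d x) (bcDirs (isUp x))

length-cellNbs : ∀ x → length (cellNbs x) ≡ 3
length-cellNbs x = trans (length-map _ (sideDirs (isUp x))) (sides (isUp x))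
  where
  sides : ∀ u → length (sideDirs u) ≡ 3
  sides true  = refl
  sides false = refl

length-bcNbs : ∀ x → length (bcNbs x) ≡ 2
length-bcNbs x = trans (length-map _ (bcDirs (isUp x))) (sides (isUp x))
  where
  sides : ∀ u → length (bcDirs u) ≡ 2
  sides true  = refl
  sides false = refl

private
  sum-+1 : ∀ a b c → a + b + c + 1ℤ ≡ a + 1ℤ + b + c
  sum-+1 = solve-∀
  sum-+2 : ∀ a b c → a + b + c + 1ℤ ≡ a + (b + 1ℤ) + c
  sum-+2 = solve-∀
  sum-+3 : ∀ a b c → a + b + c + 1ℤ ≡ a + b + (c + 1ℤ)
  sum-+3 = solve-∀
  sum--1 : ∀ a b c → a + b + c - 1ℤ ≡ a - 1ℤ + b + c
  sum--1 = solve-∀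
  sum--2 : ∀ a b c → a + b + c - 1ℤ ≡ a + (b - 1ℤ) + c
  sum--2 = solve-∀
  sum--3 : ∀ a b c → a + b + c - 1ℤ ≡ a + b + (c - 1ℤ)
  sum--3 = solve-∀

  δ : Dir → ℤ
  δ A+ = 1ℤ
  δ B+ = 1ℤ
  δ C+ = 1ℤ
  δ A- = -1ℤ
  δ B- = -1ℤ
  δ C- = -1ℤ

  sum-nb : ∀ d x → sum3 x + δ d ≡ sum3 (nb d x)
  sum-nb A+ (a , b , c) = sum-+1 a b c
  sum-nb B+ (a , b , c) = sum-+2 a b c
  sum-nb C+ (a , b , c) = sum-+3 a b c
  sum-nb A- (a , b , c) = sum--1 a b c
  sum-nb B- (a , b , c) = sum--2 a b c
  sum-nb C- (a , b , c) = sum--3 a b c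

  sumsDisjoint : ∀ {k} → k ≡ 0ℤ ⊎ k ≡ -[1+ 2 ] → ¬ (k ≡ -[1+ 0 ] ⊎ k ≡ -[1+ 1 ])
  sumsDisjoint (inj₁ refl) (inj₁ ())
  sumsDisjoint (inj₁ refl) (inj₂ ())
  sumsDisjoint (inj₂ refl) (inj₁ ())
  sumsDisjoint (inj₂ refl) (inj₂ ())

  offBoard : ∀ d x → sum3 x + δ d ≡ 0ℤ ⊎ sum3 x + δ d ≡ -[1+ 2 ] → ¬ IsCell (nb d x)
  offBoard d x out cell = sumsDisjoint out (Sum.map (trans (sum-nb d x)) (trans (sum-nb d x)) cell)

sideDir : ∀ x d → IsCell x → IsCell (nb d x) → d ∈ sideDirs (isUp x)
sideDir x d cx cn with sum3 x ℤ.≟ -[1+ 0 ]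
sideDir x A- cx cn | yes _ = here refl
sideDir x B- cx cn | yes _ = there (here refl)
sideDir x C- cx cn | yes _ = there (there (here refl))
sideDir x A+ cx cn | yes up = ⊥-elim (offBoard A+ x (inj₁ (cong (_+ 1ℤ) up)) cn)
sideDir x B+ cx cn | yes up = ⊥-elim (offBoard B+ x (inj₁ (cong (_+ 1ℤ) up)) cn)
sideDir x C+ cx cn | yes up = ⊥-elim (offBoard C+ x (inj₁ (cong (_+ 1ℤ) up)) cn)
sideDir x A+ cx cn | no _ = here refl
sideDir x B+ cx cn | no _ = there (here refl)
sideDir x C+ cx cn | no _ = there (there (here refl))
sideDir x d (inj₁ up) cn | no notUp = ⊥-elim (notUp up)
sideDir x A- (inj₂ down) cn | no _ = ⊥-elim (offBoard A- x (inj₂ (cong (_+ -1ℤ) down)) cn)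
sideDir x B- (inj₂ down) cn | no _ = ⊥-elim (offBoard B- x (inj₂ (cong (_+ -1ℤ) down)) cn)
sideDir x C- (inj₂ down) cn | no _ = ⊥-elim (offBoard C- x (inj₂ (cong (_+ -1ℤ) down)) cn)

cellNb : ∀ x d → IsCell x → IsCell (nb d x) → nb d x ∈ cellNbs x
cellNb x d cx cn = ∈-map⁺ (λ d → nb d x) (sideDir x d cx cn)

bcNb : ∀ x {d} → AcrossBC d → IsCell x → IsCell (nb d x) → nb d x ∈ bcNbs x
bcNb x bc cx cn = ∈-map⁺ (λ d → nb d x) (restrict (isUp x) bc (sideDir x _ cx cn))
  where
  restrict : ∀ u {d} → AcrossBC d → d ∈ sideDirs u → d ∈ bcDirs u
  restrict true  ()  (here refl)
  restrict true  _   (there e) = e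
  restrict false ()  (here refl)
  restrict false _   (there e) = e

bound : List Triple → ℕ
bound [] = 0
bound ((a , _) ∷ L) = ∣ a ∣ ⊔ bound L

bound-≤ : ∀ {t L} → t ∈ L → ∣ proj₁ t ∣ ≤ bound L
bound-≤ {L = (a , _) ∷ L} (here refl) = ℕP.m≤m⊔n ∣ a ∣ (bound L)
bound-≤ {L = (a , _) ∷ L} (there t∈) = ℕP.≤-trans (bound-≤ t∈) (ℕP.m≤n⊔m ∣ a ∣ (bound L))

newCell : List Triple → Triple
newCell L = + suc (bound L) , -[1+ suc (bound L) ] , 0ℤ

newCell-∉ : ∀ L → newCell L ∉ L
newCell-∉ L n∈ = ℕP.<-irrefl refl (bound-≤ {newCell L} n∈)

newCell-isCell : ∀ L → IsCell (newCell L)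
newCell-isCell L = inj₁ (trans (ℤP.+-identityʳ _) (n⊖1+n (suc (bound L))))
  where
  n⊖1+n : ∀ n → n ℤ.⊖ suc n ≡ -[1+ 0 ]
  n⊖1+n zero = refl
  n⊖1+n (suc n) = trans (ℤP.[1+m]⊖[1+n]≡m⊖n n (suc n)) (n⊖1+n n)

freshMove : ∀ k marked → ∃ λ m → LegalMove k marked m
freshMove zero marked = [] , refl , [] , [] , []
freshMove (suc k) marked with freshMove k (newCell marked ∷ marked)
... | m , len , unique , cells , avoid =
  newCell marked ∷ m , cong suc len
  , All.map (λ z∉ e → z∉ (here (sym e))) avoid ∷ unique
  , newCell-isCell marked ∷ cells
  , newCell-∉ marked ∷ All.map (λ z∉ z∈ → z∉ (there z∈)) avoid

concatMoves : ∀ {j k marked m₁ m₂} → LegalMove j marked m₁ → LegalMove k (marked ++ m₁) m₂ →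
              LegalMove (j ℕ.+ k) marked (m₁ ++ m₂)
concatMoves {marked = marked} {m₁} {m₂} (refl , u₁ , c₁ , a₁) (refl , u₂ , c₂ , a₂) =
    length-++ m₁
  , UniqueP.++⁺ u₁ u₂ (λ (z∈₁ , z∈₂) → All.lookup a₂ z∈₂ (∈-++⁺ʳ marked z∈₁))
  , AllP.++⁺ c₁ c₂
  , AllP.++⁺ a₁ (All.map (λ z∉ z∈ → z∉ (∈-++⁺ˡ z∈)) a₂)

record Blocking (k : ℕ) (marked candidates : List Triple) : Set where
  field
    cells  : List Triple
    legal  : LegalMove k marked cells
    blocks : ∀ {z} → z ∈ candidates → IsCell z → z ∈ marked ⊎ z ∈ cells

blockMove : ∀ k marked candidates → length candidates ≤ k → Blocking k marked candidates
blockMove k marked candidates short = record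
  { cells = targets ++ proj₁ padding
  ; legal = subst (λ n → LegalMove n marked (targets ++ proj₁ padding))
                  (ℕP.m+[n∸m]≡n few) (concatMoves targetsLegal (proj₂ padding))
  ; blocks = blocks }
  where
  free? : ∀ z → Dec (IsCell z × z ∉ marked)
  free? z = isCell? z ×-dec ¬? (z ∈? marked)
  distinct : List Triple
  distinct = deduplicate _≟T_ candidates
  targets : List Triple
  targets = filter free? distinct
  few : length targets ≤ k
  few = ℕP.≤-trans (length-filter free? distinct) (ℕP.≤-trans (length-deduplicate _≟T_ candidates) short)
  targetsLegal : LegalMove (length targets) marked targets
  targetsLegal = refl , UniqueP.filter⁺ free? (deduplicate-! candidates)
               , All.map proj₁ (AllP.all-filter free? distinct) , All.map proj₂ (AllP.all-filter free? distinct)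
  padding : ∃ λ m → LegalMove (k ∸ length targets) (marked ++ targets) m
  padding = freshMove (k ∸ length targets) (marked ++ targets)
  blocks : ∀ {z} → z ∈ candidates → IsCell z → z ∈ marked ⊎ z ∈ targets ++ proj₁ padding
  blocks {z} z∈ cz with z ∈? marked
  ... | yes z∈marked = inj₁ z∈marked
  ... | no z∉marked = inj₂ (∈-++⁺ˡ (∈-filter⁺ free? (∈-deduplicate⁺ _≟T_ z∈) (cz , z∉marked)))

Disjoint : List Triple → List Triple → Set
Disjoint M B = ∀ {z} → z ∈ M → z ∉ B

∉-++ : ∀ {z : Triple} M {B : List Triple} → z ∉ M ++ B → z ∉ M × z ∉ B
∉-++ M z∉ = (λ z∈ → z∉ (∈-++⁺ˡ z∈)) , (λ z∈ → z∉ (∈-++⁺ʳ M z∈))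

regroup : ∀ (m M B br : List Triple) {z} → z ∈ m ++ M ++ B ⊎ z ∈ br → z ∈ m ++ M ⊎ z ∈ br ++ B
regroup m M B br (inj₂ z∈br) = inj₂ (∈-++⁺ˡ z∈br)
regroup m M B br (inj₁ z∈) with ∈-++⁻ m z∈
... | inj₁ z∈m = inj₁ (∈-++⁺ˡ z∈m)
... | inj₂ z∈MB with ∈-++⁻ M z∈MB
...   | inj₁ z∈M = inj₁ (∈-++⁺ʳ m z∈M)
...   | inj₂ z∈B = inj₂ (∈-++⁺ʳ br z∈B)

disjoint-step : ∀ {a b : ℕ} {M B m br : List Triple} → Disjoint M B → LegalMove a (M ++ B) m →
                LegalMove b (m ++ M ++ B) br → Disjoint (m ++ M) (br ++ B)
disjoint-step {M = M} {B} {m} {br} disj (_ , _ , _ , m-free) (_ , _ , _ , br-free) z∈ z∈' with ∈-++⁻ br z∈'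
... | inj₁ z∈br = All.lookup br-free z∈br (Sum.[ ∈-++⁺ˡ , (λ z∈M → ∈-++⁺ʳ m (∈-++⁺ˡ z∈M)) ]′ (∈-++⁻ m z∈))
... | inj₂ z∈B with ∈-++⁻ m z∈
...   | inj₁ z∈m = All.lookup m-free z∈m (∈-++⁺ʳ M z∈B)
...   | inj₂ z∈M = disj z∈M z∈B

record BreakerInvariant (A : List Triple) (a b : ℕ) : Set₁ where
  field
    Safe   : List Triple → List Triple → Set
    noCopy : ∀ {M B} → Safe M B → ¬ ContainsCopy A M
    answer : ∀ {M B} → Safe M B → ∀ m → LegalMove a (M ++ B) m →
             ∃ λ br → LegalMove b (m ++ M ++ B) br × Safe (m ++ M) (br ++ B)

module _ {A a b} (I : BreakerInvariant A a b) where
  open BreakerInvariant I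

  invariant⇒noWin : ∀ {M B} → Safe M B → ¬ MakerWins A a b M B
  invariant⇒noWin s (move m legal (inj₁ copy)) = noCopy (proj₂ (proj₂ (answer s m legal))) copy
  invariant⇒noWin s (move m legal (inj₂ next)) with answer s m legal
  ... | br , br-legal , s' = invariant⇒noWin s' (next br br-legal)

-- (1,b), b ≥ 2.  Breaker keeps every B/C-neighbour of a maker cell.

record BCBlocked (M B : List Triple) : Set where
  field
    disjoint : Disjoint M B
    cells    : All IsCell M
    blocked  : ∀ {y} → y ∈ M → ∀ {d} → AcrossBC d → IsCell (nb d y) → nb d y ∈ B

-- A wedge needs an arm across a B/C-edge, but breaker holds all of those.
bcBlocked⇒noWedge : ∀ {M B} → BCBlocked M B → ¬ Wedge M
bcBlocked⇒noWedge {M} I w = Sum.[ armBlocked arm₁∈ , armBlocked arm₂∈ ]′ acrossBC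
  where
  open BCBlocked I
  open Wedge w
  armBlocked : ∀ {d} → nb d centre ∈ M → AcrossBC d → ⊥
  armBlocked a∈ bc = disjoint a∈ (blocked centre∈ bc (All.lookup cells a∈))

-- A B/C-neighbour of x already held by maker
-- is impossible: x itself would then be a B/C-neighbour of a maker cell,
-- hence breaker's.
bcBlocking : ∀ b → 2 ≤ b → BreakerInvariant T31 1 b
bcBlocking b 2≤b = record
  { Safe = BCBlocked
  ; noCopy = λ I copy → bcBlocked⇒noWedge I (copy⇒wedge copy)
  ; answer = answer }
  where
  answer : ∀ {M B} → BCBlocked M B → ∀ m → LegalMove 1 (M ++ B) m →
           ∃ λ br → LegalMove b (m ++ M ++ B) br × BCBlocked (m ++ M) (br ++ B)
  answer {M} {B} I (x ∷ []) legal@(refl , _ , cx ∷ [] , x-free ∷ []) =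
    R.cells , R.legal , record
      { disjoint = disjoint-step disjoint legal R.legal
      ; cells = cx ∷ cells
      ; blocked = blocked' }
    where
    open BCBlocked I
    module R = Blocking (blockMove b (x ∷ M ++ B) (bcNbs x) (subst (_≤ b) (sym (length-bcNbs x)) 2≤b))
    x∉B : x ∉ B
    x∉B = proj₂ (∉-++ M x-free)
    blocked' : ∀ {y} → y ∈ x ∷ M → ∀ {d} → AcrossBC d → IsCell (nb d y) → nb d y ∈ R.cells ++ B
    blocked' (there y∈M) bc cn = ∈-++⁺ʳ R.cells (blocked y∈M bc cn)
    blocked' (here refl) {d} bc cn with regroup (x ∷ []) M B R.cells (R.blocks (bcNb x bc cx cn) cn)
    ... | inj₂ taken = taken
    ... | inj₁ (here loop) = ⊥-elim (nb-irrefl d x loop)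
    ... | inj₁ (there n∈M) =
      ⊥-elim (x∉B (subst (_∈ B) (nb-opp d x)
                     (blocked n∈M (opp-AcrossBC bc) (subst IsCell (sym (nb-opp d x)) cx))))
  answer I [] (() , _)
  answer I (_ ∷ _ ∷ _) (() , _)

loser1 : ∀ b → 2 ≤ b → ¬ Winner T31 1 b
loser1 b 2≤b = invariant⇒noWin (bcBlocking b 2≤b) (record { disjoint = λ () ; cells = [] ; blocked = λ () })

-- (2,b), b ≥ 6.  Breaker keeps every neighbour of a maker cell marked.

record Surrounded (M B : List Triple) : Set where
  field
    disjoint : Disjoint M B
    cells    : All IsCell M
    closed   : ∀ {y} → y ∈ M → ∀ d → IsCell (nb d y) → nb d y ∈ M ⊎ nb d y ∈ B
    noWedge  : ¬ Wedge M

-- Two cells never form a wedge: an arm differs from the centre, so both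
-- arms would be the other cell.
noWedge-pair : ∀ {x y} → ¬ Wedge (x ∷ y ∷ [])
noWedge-pair {x} {y} w = twoCells centre∈ arm₁∈ arm₂∈
  where
  open Wedge w
  twoCells : centre ∈ x ∷ y ∷ [] → nb d₁ centre ∈ x ∷ y ∷ [] → nb d₂ centre ∈ x ∷ y ∷ [] → ⊥
  twoCells (here c) (here a) _ = nb-irrefl d₁ centre (trans a (sym c))
  twoCells (here c) _ (here a) = nb-irrefl d₂ centre (trans a (sym c))
  twoCells (here _) (there (here a₁)) (there (here a₂)) = distinct (trans a₁ (sym a₂))
  twoCells (there (here c)) (there (here a)) _ = nb-irrefl d₁ centre (trans a (sym c))
  twoCells (there (here c)) _ (there (here a)) = nb-irrefl d₂ centre (trans a (sym c))
  twoCells (there (here _)) (here a₁) (here a₂) = distinct (trans a₁ (sym a₂))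

-- In a surrounded position, free cells N are not adjacent to maker's cells,
-- so a wedge among N ++ M lies entirely within N or within M.
module _ {M B N : List Triple} (I : Surrounded M B)
         (N-free : All (_∉ M ++ B) N) (N-cells : All IsCell N) where
  open Surrounded I

  private
    marked : ∀ {z} → z ∈ M ⊎ z ∈ B → z ∈ M ++ B
    marked = Sum.[ ∈-++⁺ˡ , ∈-++⁺ʳ M ]′

    old-arm : ∀ {c} d → c ∈ M → nb d c ∈ N ++ M → nb d c ∈ M
    old-arm d c∈M a∈ with ∈-++⁻ N a∈
    ... | inj₂ a∈M = a∈M
    ... | inj₁ a∈N = ⊥-elim (All.lookup N-free a∈N (marked (closed c∈M d (All.lookup N-cells a∈N))))

    new-arm : ∀ {c} d → c ∈ N → nb d c ∈ N ++ M → nb d c ∈ N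
    new-arm {c} d c∈N a∈ with ∈-++⁻ N a∈
    ... | inj₁ a∈N = a∈N
    ... | inj₂ a∈M = ⊥-elim (All.lookup N-free c∈N (subst (_∈ M ++ B) (nb-opp d c)
                       (marked (closed a∈M (opp d) (subst IsCell (sym (nb-opp d c)) (All.lookup N-cells c∈N))))))

  split-wedge : Wedge (N ++ M) → Wedge N ⊎ Wedge M
  split-wedge w with ∈-++⁻ N (Wedge.centre∈ w)
  ... | inj₁ c∈N = inj₁ (relocate w c∈N (new-arm _ c∈N (Wedge.arm₁∈ w)) (new-arm _ c∈N (Wedge.arm₂∈ w)))
  ... | inj₂ c∈M = inj₂ (relocate w c∈M (old-arm _ c∈M (Wedge.arm₁∈ w)) (old-arm _ c∈M (Wedge.arm₂∈ w)))

surrounding : ∀ b → 6 ≤ b → BreakerInvariant T31 2 b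
surrounding b 6≤b = record
  { Safe = Surrounded
  ; noCopy = λ I copy → Surrounded.noWedge I (copy⇒wedge copy)
  ; answer = answer }
  where
  answer : ∀ {M B} → Surrounded M B → ∀ m → LegalMove 2 (M ++ B) m →
           ∃ λ br → LegalMove b (m ++ M ++ B) br × Surrounded (m ++ M) (br ++ B)
  answer {M} {B} I (x ∷ y ∷ []) legal@(refl , _ , cx ∷ cy ∷ [] , x-free ∷ y-free ∷ []) =
    R.cells , R.legal , record
      { disjoint = disjoint-step disjoint legal R.legal
      ; cells = cx ∷ cy ∷ cells
      ; closed = closed'
      ; noWedge = Sum.[ noWedge-pair , noWedge ]′ ∘ split-wedge I (x-free ∷ y-free ∷ []) (cx ∷ cy ∷ []) }
    where
    open Surrounded I
    six : length (cellNbs x ++ cellNbs y) ≡ 6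
    six = trans (length-++ (cellNbs x)) (cong₂ ℕ._+_ (length-cellNbs x) (length-cellNbs y))
    module R = Blocking (blockMove b (x ∷ y ∷ M ++ B) (cellNbs x ++ cellNbs y) (subst (_≤ b) (sym six) 6≤b))
    closed' : ∀ {z} → z ∈ x ∷ y ∷ M → ∀ d → IsCell (nb d z) → nb d z ∈ x ∷ y ∷ M ⊎ nb d z ∈ R.cells ++ B
    closed' (here refl) d cn =
      regroup (x ∷ y ∷ []) M B R.cells (R.blocks (∈-++⁺ˡ (cellNb x d cx cn)) cn)
    closed' (there (here refl)) d cn =
      regroup (x ∷ y ∷ []) M B R.cells (R.blocks (∈-++⁺ʳ (cellNbs x) (cellNb y d cy cn)) cn)
    closed' (there (there z∈M)) d cn = Sum.map (there ∘ there) (∈-++⁺ʳ R.cells) (closed z∈M d cn)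
  answer I [] (() , _)
  answer I (_ ∷ []) (() , _)
  answer I (_ ∷ _ ∷ _ ∷ _) (() , _)

loser2 : ∀ b → 6 ≤ b → ¬ Winner T31 2 b
loser2 b 6≤b = invariant⇒noWin (surrounding b 6≤b)
  (record { disjoint = λ () ; cells = [] ; closed = λ () ; noWedge = λ w → case Wedge.centre∈ w of λ () })

remove : ∀ {X : Set} {x : X} ys → x ∈ ys → List X
remove (_ ∷ ys) (here _) = ys
remove (y ∷ ys) (there x∈) = y ∷ remove ys x∈

length-remove : ∀ {X : Set} {x : X} ys (x∈ : x ∈ ys) → suc (length (remove ys x∈)) ≡ length ys
length-remove (_ ∷ _) (here _) = refl
length-remove (_ ∷ ys) (there x∈) = cong suc (length-remove ys x∈)

∈-remove : ∀ {X : Set} {x z : X} ys (x∈ : x ∈ ys) → z ∈ ys → z ≢ x → z ∈ remove ys x∈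
∈-remove (_ ∷ _) (here refl) (here refl) z≢x = ⊥-elim (z≢x refl)
∈-remove (_ ∷ _) (here _) (there z∈) _ = z∈
∈-remove (_ ∷ _) (there _) (here refl) _ = here refl
∈-remove (_ ∷ ys) (there x∈) (there z∈) z≢x = there (∈-remove ys x∈ z∈ z≢x)

unique-⊆-length : ∀ {X : Set} {xs ys : List X} → Unique xs → All (_∈ ys) xs → length xs ≤ length ys
unique-⊆-length [] [] = z≤n
unique-⊆-length {xs = x ∷ xs} {ys} (x∉xs ∷ u) (x∈ ∷ xs⊆) =
  subst (suc (length xs) ≤_) (length-remove ys x∈)
    (s≤s (unique-⊆-length u (All.zipWith (λ (z∈ , x≢z) → ∈-remove ys x∈ z∈ (x≢z ∘ sym)) (xs⊆ , x∉xs))))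

pigeonhole : ∀ {X : Set} → DecidableEquality X → ∀ {xs ys : List X} →
             Unique xs → length ys < length xs → ∃ λ x → x ∈ xs × x ∉ ys
pigeonhole _≟_ {xs} {ys} u short with All.all? (λ x → any? (x ≟_) ys) xs
... | yes xs⊆ys = ⊥-elim (ℕP.<⇒≱ short (unique-⊆-length u xs⊆ys))
... | no escapes = find (AllP.¬All⇒Any¬ (λ x → any? (x ≟_) ys) xs escapes)

finishingMove : ∀ {A a b M B} m → length m ≡ a → Unique m → All IsCell m →
                All (_∉ M) m → All (_∉ B) m → ContainsCopy A (m ++ M) → MakerWins A a b M B
finishingMove {M = M} m len u cells ∉M ∉B copy =
  move m (len , u , cells , All.zipWith (λ (z∉M , z∉B) z∈ → Sum.[ z∉M , z∉B ]′ (∈-++⁻ M z∈)) (∉M , ∉B))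
    (inj₁ copy)

threatWin : ∀ {A b M B} cs → Unique cs → All IsCell cs → All (_∉ M) cs →
            length B < length cs → All (λ c → ContainsCopy A (c ∷ M)) cs → MakerWins A 1 b M B
threatWin cs u cells ∉M short copies with pigeonhole _≟T_ u short
... | c , c∈ , c∉B =
  finishingMove (c ∷ []) refl ([] ∷ []) (All.lookup cells c∈ ∷ []) (All.lookup ∉M c∈ ∷ []) (c∉B ∷ [])
    (All.lookup copies c∈)

winnerBig : ∀ n b → 3 ≤ n → Winner T31 n b
winnerBig n b 3≤n = move m legal (inj₁ (identity , here refl ∷ there (here refl) ∷ there (there (here refl)) ∷ []))
  where
  padding : ∃ λ pad → LegalMove (n ∸ 3) T31 pad
  padding = freshMove (n ∸ 3) T31
  m : List Triple
  m = T31 ++ proj₁ padding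
  legal : LegalMove n [] m
  legal = subst (λ k → LegalMove k [] m) (ℕP.m+[n∸m]≡n 3≤n)
                (concatMoves (from-yes (legal? 3 [] T31)) (proj₂ padding))

-- Maker takes tC and then one of its two "wings" tP, tR that breaker
-- left free.  With tC and the wing y, maker threatens three cells: the other
-- wing and the cells across the A-edges of tC and of y.

data Wing : Set where
  left right : Wing

wingCell otherWing apex : Wing → Triple
wingCell left  = tP
wingCell right = tR
otherWing left  = tR
otherWing right = tP
apex left  = 0ℤ , -1ℤ , 0ℤ
apex right = 0ℤ , 0ℤ , -1ℤ

threats : Wing → List Triple
threats w = otherWing w ∷ (-[1+ 1 ] , 0ℤ , 0ℤ) ∷ apex w ∷ []

record WingFacts (w : Wing) : Set where
  field
    isCell     : IsCell (wingCell w)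
    ≢centre    : wingCell w ≢ tC
    unique     : Unique (threats w)
    cells      : All IsCell (threats w)
    free       : All (_∉ wingCell w ∷ tC ∷ []) (threats w)
    completing : All (λ c → ContainsCopy T31 (c ∷ wingCell w ∷ tC ∷ [])) (threats w)

checkWing : ∀ w → Maybe (WingFacts w)
checkWing w
  with isCell? (wingCell w) | wingCell w ≟T tC | unique? (threats w) | All.all? isCell? (threats w)
     | All.all? (λ c → ¬? (c ∈? wingCell w ∷ tC ∷ [])) (threats w)
     | searchAll (λ c → searchCopy T31 (c ∷ wingCell w ∷ tC ∷ [])) (threats w)
... | yes c | no n | yes u | yes cs | yes f | just k = just (record
  { isCell = c ; ≢centre = n ; unique = u ; cells = cs ; free = f ; completing = k })
... | _ | _ | _ | _ | _ | _ = nothing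

wingFacts : ∀ w → WingFacts w
wingFacts left  = from-just (checkWing left)
wingFacts right = from-just (checkWing right)

freeWing : ∀ β → ∃ λ w → wingCell w ≢ β
freeWing β with β ≟T tP
... | yes refl = right , λ ()
... | no β≢tP = left , β≢tP ∘ sym

winner11 : Winner T31 1 1
winner11 = move (tC ∷ []) (from-yes (legal? 1 [] (tC ∷ []))) (inj₂ secondMove)
  where
  secondMove : ∀ br → LegalMove 1 (tC ∷ []) br → MakerWins T31 1 1 (tC ∷ []) (br ++ [])
  secondMove (β ∷ []) _ with freeWing β
  ... | w , w≢β =
    move (wingCell w ∷ []) (refl , [] ∷ [] , isCell ∷ [] , AllP.All¬⇒¬Any (≢centre ∷ w≢β ∷ []) ∷ [])
      (inj₂ λ γs (len , _) →
         threatWin (threats w) unique cells free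
           (subst (_< 3) (sym (trans (length-++ γs) (cong (ℕ._+ 1) len))) ℕP.≤-refl) completing)
    where open WingFacts (wingFacts w)
  secondMove [] (() , _)
  secondMove (_ ∷ _ ∷ _) (() , _)

-- A star around a maker cell q: its three neighbours n₁ n₂ n₃ and,
-- for each nᵢ, two cells fᵢ fᵢ' with {q, nᵢ, fᵢ} and {q, nᵢ, fᵢ'} copies of
-- T₃,₁.

record Star : Set where
  field n₁ n₂ n₃ f₁ f₁' f₂ f₂' f₃ f₃' : Triple

winningPairs : Star → List (Triple × Triple)
winningPairs S = (n₁ , n₂) ∷ (n₁ , n₃) ∷ (n₂ , n₃) ∷ (n₁ , f₁) ∷ (n₁ , f₁')
               ∷ (n₂ , f₂) ∷ (n₂ , f₂') ∷ (n₃ , f₃) ∷ (n₃ , f₃') ∷ []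
  where open Star S

coverings : Star → List (List Triple)
coverings S = (n₁ ∷ n₂ ∷ n₃ ∷ []) ∷ (n₂ ∷ n₃ ∷ f₁ ∷ []) ∷ (n₁ ∷ n₃ ∷ f₂ ∷ []) ∷ (n₁ ∷ n₂ ∷ f₃ ∷ []) ∷ []
  where open Star S

coverings-size : ∀ S → All (λ s → length s ≡ 3) (coverings S)
coverings-size S = refl ∷ refl ∷ refl ∷ refl ∷ []

-- Breaker's cells either leave a winning pair free or contain a covering:
-- if two of the nᵢ are free they form a pair; if only nᵢ is free, either
-- fᵢ or fᵢ' is free or the covering {nⱼ, nₖ, fᵢ} is occupied.
star-dichotomy : ∀ S br → (∃ λ p → p ∈ winningPairs S × proj₁ p ∉ br × proj₂ p ∉ br)
                        ⊎ (∃ λ s → s ∈ coverings S × All (_∈ br) s)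
star-dichotomy S br with Star.n₁ S ∈? br | Star.n₂ S ∈? br | Star.n₃ S ∈? br
... | no p | no q | _ = inj₁ (_ , here refl , p , q)
... | no p | _ | no r = inj₁ (_ , there (here refl) , p , r)
... | _ | no q | no r = inj₁ (_ , there (there (here refl)) , q , r)
... | yes p | yes q | yes r = inj₂ (_ , here refl , p ∷ q ∷ r ∷ [])
... | no p | yes q | yes r with Star.f₁ S ∈? br | Star.f₁' S ∈? br
...   | no g | _ = inj₁ (_ , there (there (there (here refl))) , p , g)
...   | yes g | no h = inj₁ (_ , there (there (there (there (here refl)))) , p , h)
...   | yes g | yes _ = inj₂ (_ , there (here refl) , q ∷ r ∷ g ∷ [])
star-dichotomy S br | yes p | no q | yes r with Star.f₂ S ∈? br | Star.f₂' S ∈? br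
...   | no g | _ = inj₁ (_ , there (there (there (there (there (here refl))))) , q , g)
...   | yes g | no h = inj₁ (_ , there (there (there (there (there (there (here refl)))))) , q , h)
...   | yes g | yes _ = inj₂ (_ , there (there (here refl)) , p ∷ r ∷ g ∷ [])
star-dichotomy S br | yes p | yes q | no r with Star.f₃ S ∈? br | Star.f₃' S ∈? br
...   | no g | _ = inj₁ (_ , there (there (there (there (there (there (there (here refl))))))) , r , g)
...   | yes g | no h = inj₁ (_ , there (there (there (there (there (there (there (there (here refl)))))))) , r , h)
...   | yes g | yes _ = inj₂ (_ , there (there (there (here refl))) , p ∷ q ∷ g ∷ [])

PairWins : List Triple → Triple × Triple → Set
PairWins M (u , v) = u ≢ v × IsCell u × IsCell v × u ∉ M × v ∉ M × ContainsCopy T31 (u ∷ v ∷ M)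

pairWins? : ∀ M p → Maybe (PairWins M p)
pairWins? M (u , v) with ¬? (u ≟T v) ×-dec isCell? u ×-dec isCell? v ×-dec ¬? (u ∈? M) ×-dec ¬? (v ∈? M)
                       | searchCopy T31 (u ∷ v ∷ M)
... | yes (u≢v , cu , cv , u∉ , v∉) | just copy = just (u≢v , cu , cv , u∉ , v∉ , copy)
... | _ | _ = nothing

pairWin : ∀ {b M B p} → PairWins M p → proj₁ p ∉ B → proj₂ p ∉ B → MakerWins T31 2 b M B
pairWin {p = u , v} (u≢v , cu , cv , u∉M , v∉M , copy) u∉B v∉B =
  finishingMove (u ∷ v ∷ []) refl ((u≢v ∷ []) ∷ [] ∷ []) (cu ∷ cv ∷ []) (u∉M ∷ v∉M ∷ []) (u∉B ∷ v∉B ∷ []) copy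

-- Maker's first move: tC and a far cell yC, the centres of two stars.
yC : Triple
yC = + 9 , -[1+ 9 ] , 0ℤ

centres : List Triple
centres = tC ∷ yC ∷ []

-- the star around tC; the star around yC is its translate by (10, -10, 0)
starX starY : Star
starX = record { n₁ = -[1+ 1 ] , 0ℤ , 0ℤ ; n₂ = tP ; n₃ = tR
               ; f₁ = -[1+ 1 ] , 1ℤ , 0ℤ ; f₁' = -[1+ 1 ] , 0ℤ , 1ℤ
               ; f₂ = 0ℤ , -1ℤ , 0ℤ ; f₂' = -1ℤ , -1ℤ , 1ℤ
               ; f₃ = 0ℤ , 0ℤ , -1ℤ ; f₃' = -1ℤ , 1ℤ , -1ℤ }
starY = record { n₁ = + 8 , -[1+ 9 ] , 0ℤ ; n₂ = + 9 , -[1+ 10 ] , 0ℤ ; n₃ = + 9 , -[1+ 9 ] , -1ℤ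
               ; f₁ = + 8 , -[1+ 8 ] , 0ℤ ; f₁' = + 8 , -[1+ 9 ] , 1ℤ
               ; f₂ = + 10 , -[1+ 10 ] , 0ℤ ; f₂' = + 9 , -[1+ 10 ] , 1ℤ
               ; f₃ = + 10 , -[1+ 9 ] , -1ℤ ; f₃' = + 9 , -[1+ 8 ] , -1ℤ }

starX-wins : All (PairWins centres) (winningPairs starX)
starX-wins = from-just (searchAll (pairWins? centres) (winningPairs starX))

starY-wins : All (PairWins centres) (winningPairs starY)
starY-wins = from-just (searchAll (pairWins? centres) (winningPairs starY))

coverings-apart : All (λ s → All (λ t → Unique (s ++ t)) (coverings starY)) (coverings starX)
coverings-apart = from-yes (All.all? (λ s → All.all? (λ t → unique? (s ++ t)) (coverings starY)) (coverings starX))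

-- Five breaker cells cannot contain a covering of both stars.
winner25 : Winner T31 2 5
winner25 = move centres (from-yes (legal? 2 [] centres)) (inj₂ reply)
  where
  reply : ∀ br → LegalMove 5 centres br → MakerWins T31 2 5 centres (br ++ [])
  reply br (len , _) rewrite ++-identityʳ br with star-dichotomy starX br | star-dichotomy starY br
  ... | inj₁ (_ , p∈ , u∉ , v∉) | _ = pairWin (All.lookup starX-wins p∈) u∉ v∉
  ... | inj₂ _ | inj₁ (_ , p∈ , u∉ , v∉) = pairWin (All.lookup starY-wins p∈) u∉ v∉
  ... | inj₂ (s , s∈ , s⊆br) | inj₂ (t , t∈ , t⊆br) = ⊥-elim (ℕP.<-irrefl refl six≤five)
    where
    six : length (s ++ t) ≡ 6
    six = trans (length-++ s) (cong₂ ℕ._+_ (All.lookup (coverings-size starX) s∈) (All.lookup (coverings-size starY) t∈))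
    six≤five : 6 ≤ 5
    six≤five = subst₂ _≤_ six len
                 (unique-⊆-length (All.lookup (All.lookup coverings-apart s∈) t∈) (AllP.++⁺ s⊆br t⊆br))

proposition6p2 : Winner T31 1 1
    × ((b : ℕ) → 2 ≤ b → ¬ Winner T31 1 b)
    × Winner T31 2 5
    × ((b : ℕ) → 6 ≤ b → ¬ Winner T31 2 b)
    × ((n b : ℕ) → 3 ≤ n → Winner T31 n b)
proposition6p2 = winner11 , loser1 , winner25 , loser2 , winnerBig
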